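{- For all integers $p,q\ge 1$, the lattice graph $G(p,q)$ defined below satisfies $$M(G(p,q);x,y)=(2p+6)x^2y^2+(8p+8q-4)x^2y^3+(15pq-10p+2q-1)x^3y^3 .$$
   Context: For a finite simple graph $G$ and integers $i,j\ge 1$, let $m_{i,j}(G)$ be the number of edges $uv$ of $G$ with $\{d_u(G),d_v(G)\}=\{i,j\}$, where $d_v(G)$ is the degree of $v$. The $M$-polynomial of $G$ is $M(G;x,y)=\sum_{i\le j} m_{i,j}(G)\,x^iy^j$. The graph $G(p,q)$ ($p,q\ge 1$) is defined as follows. For each $r\in\{0,1,\dots,p\}$ there is a "hexagon row" with vertices $b^r_i$ and $t^r_i$ for $i=0,1,\dots,4q$, and edges $b^r_ib^r_{i+1}$ and $t^r_it^r_{i+1}$ for $0\le i<4q$, and $b^r_it^r_i$ for every even $i$ with $0\le i\le 4q$ (so each row is a linear chain of $2q$ hexagons). For each $r\in\{0,1,\dots,p-1\}$ there is a "band" with new vertices $u^r_k,w^r_k$ for $k=0,1,\dots,q-1$, and edges $u^r_kt^r_{4k+1}$, $u^r_kb^{r+1}_{4k+1}$, $w^r_kt^r_{4k+3}$, $w^r_kb^{r+1}_{4k+3}$ for $0\le k\le q-1$, and $w^r_ku^r_{k+1}$ for $0\le k\le q-2$. Thus $G(p,q)$ is a plane graph whose inner faces are $2q(p+1)$ hexagons, $pq$ octagons and $2p(q-1)$ pentagons; e.g. $G(1,1)$ is an octagon with two hexagons attached at the top and two at the bottom. -}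

module Defs where

open import Data.Nat using (ℕ; zero; suc; _+_; _*_; _∸_; _≤_)
import Data.Nat as ℕ
open import Data.Integer as ℤ using (ℤ; +_; -_)
open import Data.List using (List; []; _∷_; _++_; map; concatMap; upTo; filter; length)
open import Data.Product using (_×_; _,_)
open import Data.Sum using (_⊎_)
open import Relation.Binary.PropositionalEquality using (_≡_; refl; cong)
open import Relation.Nullary using (Dec; yes; no)
open import Relation.Nullary.Decidable using (_×-dec_; _⊎-dec_; map′)

data V : Set where
  b t u w : ℕ → ℕ → V

_≟V_ : (x y : V) → Dec (x ≡ y)
b r i ≟V b s j = help (r ℕ.≟ s) (i ℕ.≟ j)
  where
  help : Dec (r ≡ s) → Dec (i ≡ j) → Dec (b r i ≡ b s j)
  help (yes refl) (yes refl) = yes refl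
  help (no ne) _ = no λ { refl → ne refl }
  help _ (no ne) = no λ { refl → ne refl }
t r i ≟V t s j = help (r ℕ.≟ s) (i ℕ.≟ j)
  where
  help : Dec (r ≡ s) → Dec (i ≡ j) → Dec (t r i ≡ t s j)
  help (yes refl) (yes refl) = yes refl
  help (no ne) _ = no λ { refl → ne refl }
  help _ (no ne) = no λ { refl → ne refl }
u r i ≟V u s j = help (r ℕ.≟ s) (i ℕ.≟ j)
  where
  help : Dec (r ≡ s) → Dec (i ≡ j) → Dec (u r i ≡ u s j)
  help (yes refl) (yes refl) = yes refl
  help (no ne) _ = no λ { refl → ne refl }
  help _ (no ne) = no λ { refl → ne refl }
w r i ≟V w s j = help (r ℕ.≟ s) (i ℕ.≟ j)
  where
  help : Dec (r ≡ s) → Dec (i ≡ j) → Dec (w r i ≡ w s j)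
  help (yes refl) (yes refl) = yes refl
  help (no ne) _ = no λ { refl → ne refl }
  help _ (no ne) = no λ { refl → ne refl }
b _ _ ≟V t _ _ = no λ ()
b _ _ ≟V u _ _ = no λ ()
b _ _ ≟V w _ _ = no λ ()
t _ _ ≟V b _ _ = no λ ()
t _ _ ≟V u _ _ = no λ ()
t _ _ ≟V w _ _ = no λ ()
u _ _ ≟V b _ _ = no λ ()
u _ _ ≟V t _ _ = no λ ()
u _ _ ≟V w _ _ = no λ ()
w _ _ ≟V b _ _ = no λ ()
w _ _ ≟V t _ _ = no λ ()
w _ _ ≟V u _ _ = no λ ()

-- A (finite simple) graph given by its list of edges; each edge is an
-- unordered pair listed once, as an ordered pair.

Edge : Set
Edge = V × V

rowEdges : ℕ → ℕ → List Edge
rowEdges q r =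
  map (λ i → (b r i , b r (suc i))) (upTo (4 * q)) ++
  map (λ i → (t r i , t r (suc i))) (upTo (4 * q)) ++
  map (λ k → (b r (2 * k) , t r (2 * k))) (upTo (suc (2 * q)))

bandEdges : ℕ → ℕ → List Edge
bandEdges q r =
  concatMap (λ k → (u r k , t r (4 * k + 1)) ∷ (u r k , b (suc r) (4 * k + 1))
                 ∷ (w r k , t r (4 * k + 3)) ∷ (w r k , b (suc r) (4 * k + 3)) ∷ [])
            (upTo q) ++
  map (λ k → (w r k , u r (suc k))) (upTo (q ∸ 1))

G : ℕ → ℕ → List Edge
G p q = concatMap (rowEdges q) (upTo (suc p)) ++ concatMap (bandEdges q) (upTo p)

Incident : V → Edge → Set
Incident v (x , y) = (x ≡ v) ⊎ (y ≡ v)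

incident? : (v : V) (e : Edge) → Dec (Incident v e)
incident? v (x , y) = (x ≟V v) ⊎-dec (y ≟V v)

degree : List Edge → V → ℕ
degree E v = length (filter (incident? v) E)

HasDegreeType : List Edge → ℕ → ℕ → Edge → Set
HasDegreeType E i j (x , y) =
  ((degree E x ≡ i) × (degree E y ≡ j)) ⊎ ((degree E x ≡ j) × (degree E y ≡ i))

hasDegreeType? : (E : List Edge) (i j : ℕ) (e : Edge) → Dec (HasDegreeType E i j e)
hasDegreeType? E i j (x , y) =
  ((degree E x ℕ.≟ i) ×-dec (degree E y ℕ.≟ j)) ⊎-dec
  ((degree E x ℕ.≟ j) ×-dec (degree E y ℕ.≟ i))

-- m_{i,j}(G): the coefficient of x^i y^j (i ≤ j) in M(G;x,y)
m : List Edge → ℕ → ℕ → ℕ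
m E i j = length (filter (hasDegreeType? E i j) E)

targetCoeff : ℕ → ℕ → ℕ → ℕ → ℤ
targetCoeff p q 2 2 = + (2 * p) ℤ.+ + 6
targetCoeff p q 2 3 = + (8 * p) ℤ.+ + (8 * q) ℤ.- + 4
targetCoeff p q 3 3 = + (15 * p * q) ℤ.- + (10 * p) ℤ.+ + (2 * q) ℤ.- + 1
targetCoeff p q _ _ = + 0

module Submission where

-- Each coefficient m_{i,j} and each degree is the length of a filtered edge list.
-- Following the list structure of G(p, q) (a row: two paths of 4q edges and 2q + 1
-- rungs; a band: four spokes per octagon and the links w_k u_(k+1)), such counts
-- become finite sums ∑[ k < n ] of 0/1 indicators χ.
--  1. Degrees.  A vertex only meets its own row and the adjacent band; evaluating
--     the indicator sums shows that path ends and odd positions of the outer paths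
--     have degree 2, all other path vertices degree 3, and along a band u₀ and
--     w_(q-1) have degree 2, the other octagon vertices degree 3.
--  2. Profiles.  These facts are recorded as PathShape and ChainShape; for any
--     edge weight T depending on the end-degrees, the total weight of a path, of
--     the rungs of a row and of a band follows from the profile alone.
--  3. Taking T = τ i j, the indicator of type {i, j}, and summing over rows and
--     bands expresses m_{i,j} as a linear form in T 2 2, T 2 3, T 3 2, T 3 3 with
--     coefficients polynomial in p and q; comparing with the claimed coefficients
--     case by case proves the theorem.

open import Defs
open import Data.Nat using (ℕ; zero; suc; _+_; _*_; _∸_; _≤_; _<_; z≤n; s≤s; _≟_)
open import Data.Nat.Properties
open import Data.Integer as ℤ using (+_)
open import Data.Bool using (true; false; if_then_else_)
open import Data.List using (List; []; _∷_; _++_; map; concatMap; upTo; applyUpTo; filter; length)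
import Data.List.Properties as List
open import Data.Product using (_×_; _,_)
open import Data.Sum using (inj₁; inj₂)
open import Data.Empty using (⊥-elim)
open import Function using (_∘_; id)
open import Relation.Binary.PropositionalEquality
open import Relation.Nullary using (Dec; yes; no; does; ¬_)
open import Relation.Nullary.Decidable using (_×-dec_; _⊎-dec_)
open import Relation.Unary using (Decidable)
open import Algebra.Properties.CommutativeSemigroup +-commutativeSemigroup using (interchange)
import Data.Nat.Tactic.RingSolver as ℕ-Solver
import Data.Integer.Tactic.RingSolver as ℤ-Solver

χ : ∀ {a} {A : Set a} → Dec A → ℕ
χ d = if does d then 1 else 0

χ-yes : ∀ {a} {A : Set a} (d : Dec A) → A → χ d ≡ 1
χ-yes (yes _) _ = refl
χ-yes (no ¬x) x = ⊥-elim (¬x x)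

χ-no : ∀ {a} {A : Set a} (d : Dec A) → ¬ A → χ d ≡ 0
χ-no (yes x) ¬x = ⊥-elim (¬x x)
χ-no (no _) _ = refl

χ-iff : ∀ {a b} {A : Set a} {B : Set b} (dA : Dec A) (dB : Dec B) →
        (A → B) → (B → A) → χ dA ≡ χ dB
χ-iff (yes _) (yes _) _ _ = refl
χ-iff (yes x) (no ¬y) f _ = ⊥-elim (¬y (f x))
χ-iff (no ¬x) (yes y) _ g = ⊥-elim (¬x (g y))
χ-iff (no _) (no _) _ _ = refl

χ-⊎ : ∀ {a b} {A : Set a} {B : Set b} (dA : Dec A) (dB : Dec B) →
      ¬ (A × B) → χ (dA ⊎-dec dB) ≡ χ dA + χ dB
χ-⊎ (yes x) (yes y) excl = ⊥-elim (excl (x , y))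
χ-⊎ (yes _) (no _) _ = refl
χ-⊎ (no _) (yes _) _ = refl
χ-⊎ (no _) (no _) _ = refl

∑ : ℕ → (ℕ → ℕ) → ℕ
∑ zero f = 0
∑ (suc n) f = f 0 + ∑ n (f ∘ suc)

syntax ∑ n (λ k → e) = ∑[ k < n ] e

∑-cong : ∀ n {f g : ℕ → ℕ} → (∀ k → k < n → f k ≡ g k) → ∑ n f ≡ ∑ n g
∑-cong zero eq = refl
∑-cong (suc n) eq = cong₂ _+_ (eq 0 (s≤s z≤n)) (∑-cong n (λ k k<n → eq (suc k) (s≤s k<n)))

∑-const : ∀ n {f : ℕ → ℕ} c → (∀ k → k < n → f k ≡ c) → ∑ n f ≡ n * c
∑-const zero c eq = refl
∑-const (suc n) c eq = cong₂ _+_ (eq 0 (s≤s z≤n)) (∑-const n c (λ k k<n → eq (suc k) (s≤s k<n)))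

∑-zero : ∀ n {f : ℕ → ℕ} → (∀ k → k < n → f k ≡ 0) → ∑ n f ≡ 0
∑-zero n eq = trans (∑-const n 0 eq) (*-zeroʳ n)

∑-+ : ∀ n (f g : ℕ → ℕ) → ∑[ k < n ] (f k + g k) ≡ ∑ n f + ∑ n g
∑-+ zero f g = refl
∑-+ (suc n) f g =
  trans (cong (λ s → f 0 + g 0 + s) (∑-+ n (f ∘ suc) (g ∘ suc))) (interchange (f 0) (g 0) _ _)

∑-last : ∀ n (f : ℕ → ℕ) → ∑ (suc n) f ≡ ∑ n f + f n
∑-last zero f = +-comm (f 0) 0
∑-last (suc n) f = trans (cong (λ s → f 0 + s) (∑-last n (f ∘ suc))) (sym (+-assoc (f 0) _ _))

∑-single : ∀ n {f : ℕ → ℕ} k₀ → k₀ < n → (∀ k → k < n → k ≢ k₀ → f k ≡ 0) → ∑ n f ≡ f k₀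
∑-single (suc n) {f} zero _ away =
  trans (cong (λ s → f 0 + s) (∑-zero n (λ k k<n → away (suc k) (s≤s k<n) (λ ())))) (+-identityʳ (f 0))
∑-single (suc n) {f} (suc k₀) (s≤s k₀<n) away =
  cong₂ _+_ (away 0 (s≤s z≤n) (λ ()))
            (∑-single n k₀ k₀<n (λ k k<n k≢k₀ → away (suc k) (s≤s k<n) (k≢k₀ ∘ suc-injective)))

∑-head : ∀ n (f : ℕ → ℕ) {a c} → f 0 ≡ a → (∀ k → k < n → f (suc k) ≡ c) → ∑ (suc n) f ≡ a + n * c
∑-head n f f₀ rest = cong₂ _+_ f₀ (∑-const n _ rest)

∑-tail : ∀ n (f : ℕ → ℕ) {a c} → (∀ k → k < n → f k ≡ c) → f n ≡ a → ∑ (suc n) f ≡ n * c + a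
∑-tail n f rest fₙ = trans (∑-last n f) (cong₂ _+_ (∑-const n _ rest) fₙ)

∑-pairs : ∀ n (f : ℕ → ℕ) → ∑ (2 * n) f ≡ ∑[ h < n ] (f (2 * h) + f (suc (2 * h)))
∑-pairs zero f = refl
∑-pairs (suc n) f = begin
  ∑ (2 * suc n) f                                          ≡⟨ cong (λ N → ∑ N f) (*-suc 2 n) ⟩
  f 0 + (f 1 + ∑ (2 * n) (f ∘ suc ∘ suc))                    ≡⟨ +-assoc (f 0) (f 1) _ ⟨
  f 0 + f 1 + ∑ (2 * n) (f ∘ suc ∘ suc)                      ≡⟨ cong (λ s → f 0 + f 1 + s) (∑-pairs n (f ∘ suc ∘ suc)) ⟩
  f 0 + f 1 + ∑[ h < n ] (f (2 + 2 * h) + f (3 + 2 * h))      ≡⟨ cong (λ s → f 0 + f 1 + s) (∑-cong n shift) ⟩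
  f 0 + f 1 + ∑[ h < n ] (f (2 * suc h) + f (suc (2 * suc h))) ∎
  where
  open ≡-Reasoning
  shift : ∀ h → h < n → f (2 + 2 * h) + f (3 + 2 * h) ≡ f (2 * suc h) + f (suc (2 * suc h))
  shift h _ = cong (λ j → f j + f (suc j)) (sym (*-suc 2 h))

∑-χ-hit : ∀ n (g : ℕ → ℕ) → (∀ {k l} → g k ≡ g l → k ≡ l) →
          ∀ k₀ → k₀ < n → ∑[ k < n ] χ (g k ≟ g k₀) ≡ 1
∑-χ-hit n g g-inj k₀ k₀<n =
  trans (∑-single n k₀ k₀<n (λ k _ k≢k₀ → χ-no (g k ≟ g k₀) (k≢k₀ ∘ g-inj))) (χ-yes (g k₀ ≟ g k₀) refl)

∑-χ-miss : ∀ n (g : ℕ → ℕ) {i} → (∀ k → k < n → g k ≢ i) → ∑[ k < n ] χ (g k ≟ i) ≡ 0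
∑-χ-miss n g miss = ∑-zero n (λ k k<n → χ-no (g k ≟ _) (miss k k<n))

count : ∀ {a p} {A : Set a} {P : A → Set p} → Decidable P → List A → ℕ
count P? xs = length (filter P? xs)

module _ {a p} {A : Set a} {P : A → Set p} (P? : Decidable P) where

  count-∷ : ∀ x xs → count P? (x ∷ xs) ≡ χ (P? x) + count P? xs
  count-∷ x xs with does (P? x)
  ... | true = refl
  ... | false = refl

  count-++ : ∀ xs ys → count P? (xs ++ ys) ≡ count P? xs + count P? ys
  count-++ xs ys = trans (cong length (List.filter-++ P? xs ys)) (List.length-++ (filter P? xs))

  count-applyUpTo : ∀ n (g : ℕ → A) → count P? (applyUpTo g n) ≡ ∑[ k < n ] χ (P? (g k))
  count-applyUpTo zero g = refl
  count-applyUpTo (suc n) g = trans (count-∷ (g 0) _) (cong (λ s → χ (P? (g 0)) + s) (count-applyUpTo n (g ∘ suc)))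

  count-map-upTo : ∀ n (g : ℕ → A) → count P? (map g (upTo n)) ≡ ∑[ k < n ] χ (P? (g k))
  count-map-upTo n g = trans (cong (count P?) (List.map-applyUpTo id g n)) (count-applyUpTo n g)

  count-concatMap : ∀ n (h : ℕ → ℕ) (g : ℕ → List A) →
                    count P? (concatMap g (applyUpTo h n)) ≡ ∑[ k < n ] count P? (g (h k))
  count-concatMap zero h g = refl
  count-concatMap (suc n) h g =
    trans (count-++ (g (h 0)) _) (cong (λ s → count P? (g (h 0)) + s) (count-concatMap n (h ∘ suc) g))

  count-four : ∀ x₁ x₂ x₃ x₄ →
               count P? (x₁ ∷ x₂ ∷ x₃ ∷ x₄ ∷ []) ≡ (χ (P? x₁) + χ (P? x₂)) + (χ (P? x₃) + χ (P? x₄))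
  count-four x₁ x₂ x₃ x₄ = begin
    count P? (x₁ ∷ x₂ ∷ x₃ ∷ x₄ ∷ [])           ≡⟨ count-∷ x₁ _ ⟩
    χ₁ + count P? (x₂ ∷ x₃ ∷ x₄ ∷ [])           ≡⟨ cong (λ s → χ₁ + s) (count-∷ x₂ _) ⟩
    χ₁ + (χ₂ + count P? (x₃ ∷ x₄ ∷ []))         ≡⟨ cong (λ n → χ₁ + (χ₂ + n)) (count-∷ x₃ _) ⟩
    χ₁ + (χ₂ + (χ₃ + count P? (x₄ ∷ [])))       ≡⟨ cong (λ n → χ₁ + (χ₂ + (χ₃ + n))) (trans (count-∷ x₄ []) (+-identityʳ χ₄)) ⟩
    χ₁ + (χ₂ + (χ₃ + χ₄))                        ≡⟨ +-assoc χ₁ χ₂ _ ⟨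
    (χ₁ + χ₂) + (χ₃ + χ₄)                        ∎
    where
    open ≡-Reasoning
    χ₁ χ₂ χ₃ χ₄ : ℕ
    χ₁ = χ (P? x₁)
    χ₂ = χ (P? x₂)
    χ₃ = χ (P? x₃)
    χ₄ = χ (P? x₄)

spokes : ℕ → ℕ → List Edge
spokes r k = (u r k , t r (4 * k + 1)) ∷ (u r k , b (suc r) (4 * k + 1))
           ∷ (w r k , t r (4 * k + 3)) ∷ (w r k , b (suc r) (4 * k + 3)) ∷ []

count-spokes : ∀ {P : Edge → Set} (P? : Decidable P) r k →
               count P? (spokes r k) ≡ (χ (P? (u r k , t r (4 * k + 1))) + χ (P? (u r k , b (suc r) (4 * k + 1))))
                                     + (χ (P? (w r k , t r (4 * k + 3))) + χ (P? (w r k , b (suc r) (4 * k + 3))))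
count-spokes P? r k = count-four P? _ _ _ _

module EdgeCount {P : Edge → Set} (P? : Decidable P) (q : ℕ) where

  rowCount : ℕ → ℕ
  rowCount r = ∑[ k < 4 * q ] χ (P? (b r k , b r (suc k)))
             + (∑[ k < 4 * q ] χ (P? (t r k , t r (suc k)))
             + ∑[ k < suc (2 * q) ] χ (P? (b r (2 * k) , t r (2 * k))))

  bandCount : ℕ → ℕ
  bandCount r = ∑[ k < q ] count P? (spokes r k) + ∑[ k < q ∸ 1 ] χ (P? (w r k , u r (suc k)))

  count-row : ∀ r → count P? (rowEdges q r) ≡ rowCount r
  count-row r =
    trans (count-++ P? (map (λ i → (b r i , b r (suc i))) (upTo (4 * q))) _)
          (cong₂ _+_ (count-map-upTo P? (4 * q) _)
                     (trans (count-++ P? (map (λ i → (t r i , t r (suc i))) (upTo (4 * q))) _)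
                            (cong₂ _+_ (count-map-upTo P? (4 * q) _) (count-map-upTo P? (suc (2 * q)) _))))

  count-band : ∀ r → count P? (bandEdges q r) ≡ bandCount r
  count-band r =
    trans (count-++ P? (concatMap (spokes r) (upTo q)) _)
          (cong₂ _+_ (count-concatMap P? q id (spokes r)) (count-map-upTo P? (q ∸ 1) _))

  count-G : ∀ p → count P? (G p q) ≡ ∑[ r < suc p ] rowCount r + ∑[ r < p ] bandCount r
  count-G p =
    trans (count-++ P? (concatMap (rowEdges q) (upTo (suc p))) _)
          (cong₂ _+_ (trans (count-concatMap P? (suc p) id (rowEdges q)) (∑-cong (suc p) (λ r _ → count-row r)))
                     (trans (count-concatMap P? p id (bandEdges q)) (∑-cong p (λ r _ → count-band r))))

row index : V → ℕ
row (b r _) = r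
row (t r _) = r
row (u r _) = r
row (w r _) = r
index (b _ i) = i
index (t _ i) = i
index (u _ i) = i
index (w _ i) = i

χ-≟V : ∀ (c : ℕ → ℕ → V) r k i → (c r k ≡ c r i → k ≡ i) → χ (c r k ≟V c r i) ≡ χ (k ≟ i)
χ-≟V c r k i c-inj = χ-iff (c r k ≟V c r i) (k ≟ i) c-inj (cong (c r))

χ-incident : ∀ v x y → x ≢ y → χ (incident? v (x , y)) ≡ χ (x ≟V v) + χ (y ≟V v)
χ-incident v x y x≢y = χ-⊎ (x ≟V v) (y ≟V v) (λ { (x≡v , y≡v) → x≢y (trans x≡v (sym y≡v)) })

χ-incident-left : ∀ v x y → y ≢ v → χ (incident? v (x , y)) ≡ χ (x ≟V v)
χ-incident-left v x y y≢v =
  χ-iff (incident? v (x , y)) (x ≟V v) (λ { (inj₁ x≡v) → x≡v ; (inj₂ y≡v) → ⊥-elim (y≢v y≡v) }) inj₁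

χ-incident-away : ∀ v x y → x ≢ v → y ≢ v → χ (incident? v (x , y)) ≡ 0
χ-incident-away v x y x≢v y≢v =
  χ-no (incident? v (x , y)) λ { (inj₁ x≡v) → x≢v x≡v ; (inj₂ y≡v) → y≢v y≡v }

rowIncidences bandIncidences : V → ℕ → ℕ → ℕ
rowIncidences v = EdgeCount.rowCount (incident? v)
bandIncidences v = EdgeCount.bandCount (incident? v)

row-away : ∀ v q r → (∀ k → b r k ≢ v) → (∀ k → t r k ≢ v) → rowIncidences v q r ≡ 0
row-away v q r b≢v t≢v = cong₂ _+_
  (∑-zero (4 * q) λ k _ → χ-incident-away v _ _ (b≢v k) (b≢v (suc k)))
  (cong₂ _+_ (∑-zero (4 * q) λ k _ → χ-incident-away v _ _ (t≢v k) (t≢v (suc k)))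
             (∑-zero (suc (2 * q)) λ k _ → χ-incident-away v _ _ (b≢v (2 * k)) (t≢v (2 * k))))

band-away : ∀ v q r → (∀ k → u r k ≢ v) → (∀ k → w r k ≢ v) → (∀ k → t r k ≢ v) → (∀ k → b (suc r) k ≢ v) →
            bandIncidences v q r ≡ 0
band-away v q r u≢v w≢v t≢v b≢v = cong₂ _+_
  (∑-zero q λ k _ → trans (count-spokes (incident? v) r k)
    (cong₂ _+_ (cong₂ _+_ (χ-incident-away v _ _ (u≢v k) (t≢v _)) (χ-incident-away v _ _ (u≢v k) (b≢v _)))
               (cong₂ _+_ (χ-incident-away v _ _ (w≢v k) (t≢v _)) (χ-incident-away v _ _ (w≢v k) (b≢v _)))))
  (∑-zero (q ∸ 1) λ k _ → χ-incident-away v _ _ (w≢v k) (u≢v (suc k)))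

-- Within its own row, the vertex at position i of either path is met by the path
-- edges k(k+1) with k = i or k + 1 = i, and by the rung at i when i is even.
rowDegree : ℕ → ℕ → ℕ
rowDegree q i = ∑[ k < 4 * q ] (χ (k ≟ i) + χ (suc k ≟ i)) + ∑[ k < suc (2 * q) ] χ (2 * k ≟ i)

-- Within an adjacent band, it is met by a spoke when i ≡ 1 or 3 (mod 4).
bandDegree : ℕ → ℕ → ℕ
bandDegree q i = ∑[ k < q ] (χ (4 * k + 1 ≟ i) + χ (4 * k + 3 ≟ i))

-- The octagon vertices u_i and w_i each carry two spokes, and are joined
-- by the links w_k u_(k+1).
uDegree wDegree : ℕ → ℕ → ℕ
uDegree q i = ∑[ k < q ] (χ (k ≟ i) + χ (k ≟ i)) + ∑[ k < q ∸ 1 ] χ (suc k ≟ i)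
wDegree q i = ∑[ k < q ] (χ (k ≟ i) + χ (k ≟ i)) + ∑[ k < q ∸ 1 ] χ (k ≟ i)

row-b : ∀ q s i → rowIncidences (b s i) q s ≡ rowDegree q i
row-b q s i = cong₂ _+_
  (∑-cong (4 * q) λ k _ → trans (χ-incident (b s i) (b s k) (b s (suc k)) (1+n≢n ∘ sym ∘ cong index))
                                (cong₂ _+_ (χ-≟V b s k i (cong index)) (χ-≟V b s (suc k) i (cong index))))
  (cong₂ _+_ (∑-zero (4 * q) λ _ _ → refl)
             (∑-cong (suc (2 * q)) λ k _ → trans (χ-incident-left (b s i) (b s (2 * k)) (t s (2 * k)) λ ())
                                                (χ-≟V b s (2 * k) i (cong index))))

row-t : ∀ q s i → rowIncidences (t s i) q s ≡ rowDegree q i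
row-t q s i = cong₂ _+_
  (∑-zero (4 * q) λ _ _ → refl)
  (cong₂ _+_ (∑-cong (4 * q) λ k _ → trans (χ-incident (t s i) (t s k) (t s (suc k)) (1+n≢n ∘ sym ∘ cong index))
                                          (cong₂ _+_ (χ-≟V t s k i (cong index)) (χ-≟V t s (suc k) i (cong index))))
             (∑-cong (suc (2 * q)) λ k _ → χ-≟V t s (2 * k) i (cong index)))

band-b : ∀ q r i → bandIncidences (b (suc r) i) q r ≡ bandDegree q i
band-b q r i = trans (cong₂ _+_ spokes-b links-b) (+-identityʳ (bandDegree q i))
  where
  spokes-b : ∑[ k < q ] count (incident? (b (suc r) i)) (spokes r k) ≡ bandDegree q i
  spokes-b = ∑-cong q λ k _ → trans (count-spokes (incident? (b (suc r) i)) r k)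
    (cong₂ _+_ (χ-≟V b (suc r) (4 * k + 1) i (cong index)) (χ-≟V b (suc r) (4 * k + 3) i (cong index)))
  links-b : ∑[ k < q ∸ 1 ] χ (incident? (b (suc r) i) (w r k , u r (suc k))) ≡ 0
  links-b = ∑-zero (q ∸ 1) λ _ _ → refl

band-t : ∀ q r i → bandIncidences (t r i) q r ≡ bandDegree q i
band-t q r i = trans (cong₂ _+_ spokes-t links-t) (+-identityʳ (bandDegree q i))
  where
  spokes-t : ∑[ k < q ] count (incident? (t r i)) (spokes r k) ≡ bandDegree q i
  spokes-t = ∑-cong q λ k _ → trans (count-spokes (incident? (t r i)) r k)
    (cong₂ _+_ (trans (+-identityʳ _) (χ-≟V t r (4 * k + 1) i (cong index)))
               (trans (+-identityʳ _) (χ-≟V t r (4 * k + 3) i (cong index))))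
  links-t : ∑[ k < q ∸ 1 ] χ (incident? (t r i) (w r k , u r (suc k))) ≡ 0
  links-t = ∑-zero (q ∸ 1) λ _ _ → refl

band-u : ∀ q r i → bandIncidences (u r i) q r ≡ uDegree q i
band-u q r i = cong₂ _+_ spokes-u links-u
  where
  u-end : ∀ k y → y ≢ u r i → χ (incident? (u r i) (u r k , y)) ≡ χ (k ≟ i)
  u-end k y y≢u = trans (χ-incident-left (u r i) (u r k) y y≢u) (χ-≟V u r k i (cong index))
  spokes-u : ∑[ k < q ] count (incident? (u r i)) (spokes r k) ≡ ∑[ k < q ] (χ (k ≟ i) + χ (k ≟ i))
  spokes-u = ∑-cong q λ k _ → trans (count-spokes (incident? (u r i)) r k)
    (trans (+-identityʳ _) (cong₂ _+_ (u-end k (t r (4 * k + 1)) λ ()) (u-end k (b (suc r) (4 * k + 1)) λ ())))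
  links-u : ∑[ k < q ∸ 1 ] χ (incident? (u r i) (w r k , u r (suc k))) ≡ ∑[ k < q ∸ 1 ] χ (suc k ≟ i)
  links-u = ∑-cong (q ∸ 1) λ k _ → χ-≟V u r (suc k) i (cong index)

band-w : ∀ q r i → bandIncidences (w r i) q r ≡ wDegree q i
band-w q r i = cong₂ _+_ spokes-w links-w
  where
  w-end : ∀ k y → y ≢ w r i → χ (incident? (w r i) (w r k , y)) ≡ χ (k ≟ i)
  w-end k y y≢w = trans (χ-incident-left (w r i) (w r k) y y≢w) (χ-≟V w r k i (cong index))
  spokes-w : ∑[ k < q ] count (incident? (w r i)) (spokes r k) ≡ ∑[ k < q ] (χ (k ≟ i) + χ (k ≟ i))
  spokes-w = ∑-cong q λ k _ → trans (count-spokes (incident? (w r i)) r k)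
    (cong₂ _+_ (w-end k (t r (4 * k + 3)) λ ()) (w-end k (b (suc r) (4 * k + 3)) λ ()))
  links-w : ∑[ k < q ∸ 1 ] χ (incident? (w r i) (w r k , u r (suc k))) ≡ ∑[ k < q ∸ 1 ] χ (k ≟ i)
  links-w = ∑-cong (q ∸ 1) λ k _ → w-end k (u r (suc k)) λ ()

degree-split : ∀ p q v → degree (G p q) v ≡ ∑[ r < suc p ] rowIncidences v q r + ∑[ r < p ] bandIncidences v q r
degree-split p q v = EdgeCount.count-G (incident? v) q p

degree-b₀ : ∀ p q i → degree (G p q) (b 0 i) ≡ rowDegree q i
degree-b₀ p q i = trans (degree-split p q (b 0 i)) (trans (cong₂ _+_ rows bands) (+-identityʳ _))
  where
  rows : ∑[ r < suc p ] rowIncidences (b 0 i) q r ≡ rowDegree q i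
  rows = trans (∑-single (suc p) 0 (s≤s z≤n) λ r _ r≢0 → row-away (b 0 i) q r (λ _ → r≢0 ∘ cong row) (λ _ ()))
               (row-b q 0 i)
  bands : ∑[ r < p ] bandIncidences (b 0 i) q r ≡ 0
  bands = ∑-zero p λ r _ → band-away (b 0 i) q r (λ _ ()) (λ _ ()) (λ _ ()) (λ _ ())

degree-b : ∀ p q r i → r < p → degree (G p q) (b (suc r) i) ≡ rowDegree q i + bandDegree q i
degree-b p q r i r<p = trans (degree-split p q (b (suc r) i)) (cong₂ _+_ rows bands)
  where
  rows : ∑[ s < suc p ] rowIncidences (b (suc r) i) q s ≡ rowDegree q i
  rows = trans (∑-single (suc p) (suc r) (s≤s r<p) λ s _ s≢r → row-away (b (suc r) i) q s (λ _ → s≢r ∘ cong row) (λ _ ()))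
               (row-b q (suc r) i)
  bands : ∑[ s < p ] bandIncidences (b (suc r) i) q s ≡ bandDegree q i
  bands = trans (∑-single p r r<p λ s _ s≢r →
                  band-away (b (suc r) i) q s (λ _ ()) (λ _ ()) (λ _ ()) (λ _ → s≢r ∘ suc-injective ∘ cong row))
                (band-b q r i)

degree-tₚ : ∀ p q i → degree (G p q) (t p i) ≡ rowDegree q i
degree-tₚ p q i = trans (degree-split p q (t p i)) (trans (cong₂ _+_ rows bands) (+-identityʳ _))
  where
  rows : ∑[ r < suc p ] rowIncidences (t p i) q r ≡ rowDegree q i
  rows = trans (∑-single (suc p) p ≤-refl λ r _ r≢p → row-away (t p i) q r (λ _ ()) (λ _ → r≢p ∘ cong row))
               (row-t q p i)
  bands : ∑[ r < p ] bandIncidences (t p i) q r ≡ 0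
  bands = ∑-zero p λ r r<p → band-away (t p i) q r (λ _ ()) (λ _ ()) (λ _ → <⇒≢ r<p ∘ cong row) (λ _ ())

degree-t : ∀ p q s i → s < p → degree (G p q) (t s i) ≡ rowDegree q i + bandDegree q i
degree-t p q s i s<p = trans (degree-split p q (t s i)) (cong₂ _+_ rows bands)
  where
  rows : ∑[ r < suc p ] rowIncidences (t s i) q r ≡ rowDegree q i
  rows = trans (∑-single (suc p) s (m≤n⇒m≤1+n s<p) λ r _ r≢s → row-away (t s i) q r (λ _ ()) (λ _ → r≢s ∘ cong row))
               (row-t q s i)
  bands : ∑[ r < p ] bandIncidences (t s i) q r ≡ bandDegree q i
  bands = trans (∑-single p s s<p λ r _ r≢s → band-away (t s i) q r (λ _ ()) (λ _ ()) (λ _ → r≢s ∘ cong row) (λ _ ()))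
                (band-t q s i)

degree-u : ∀ p q r i → r < p → degree (G p q) (u r i) ≡ uDegree q i
degree-u p q r i r<p = trans (degree-split p q (u r i)) (cong₂ _+_ rows bands)
  where
  rows : ∑[ s < suc p ] rowIncidences (u r i) q s ≡ 0
  rows = ∑-zero (suc p) λ s _ → row-away (u r i) q s (λ _ ()) (λ _ ())
  bands : ∑[ s < p ] bandIncidences (u r i) q s ≡ uDegree q i
  bands = trans (∑-single p r r<p λ s _ s≢r → band-away (u r i) q s (λ _ → s≢r ∘ cong row) (λ _ ()) (λ _ ()) (λ _ ()))
                (band-u q r i)

degree-w : ∀ p q r i → r < p → degree (G p q) (w r i) ≡ wDegree q i
degree-w p q r i r<p = trans (degree-split p q (w r i)) (cong₂ _+_ rows bands)
  where
  rows : ∑[ s < suc p ] rowIncidences (w r i) q s ≡ 0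
  rows = ∑-zero (suc p) λ s _ → row-away (w r i) q s (λ _ ()) (λ _ ())
  bands : ∑[ s < p ] bandIncidences (w r i) q s ≡ wDegree q i
  bands = trans (∑-single p r r<p λ s _ s≢r → band-away (w r i) q s (λ _ ()) (λ _ → s≢r ∘ cong row) (λ _ ()) (λ _ ()))
                (band-w q r i)

∑-χ-below : ∀ n i → i < n → ∑[ k < n ] χ (k ≟ i) ≡ 1
∑-χ-below n i = ∑-χ-hit n id id i

∑-χ-above : ∀ n i → n ≤ i → ∑[ k < n ] χ (k ≟ i) ≡ 0
∑-χ-above n i n≤i = ∑-χ-miss n id λ k k<n → <⇒≢ (<-≤-trans k<n n≤i)

∑-χ-suc : ∀ n i → i < n → ∑[ k < n ] χ (suc k ≟ suc i) ≡ 1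
∑-χ-suc n i = ∑-χ-hit n suc suc-injective i

∑-χ-suc-0 : ∀ n → ∑[ k < n ] χ (suc k ≟ 0) ≡ 0
∑-χ-suc-0 n = ∑-χ-miss n suc {0} λ _ _ ()

∑-χ-even : ∀ n h → h < n → ∑[ k < n ] χ (2 * k ≟ 2 * h) ≡ 1
∑-χ-even n h = ∑-χ-hit n (2 *_) (*-cancelˡ-≡ _ _ 2) h

∑-χ-odd : ∀ n h → ∑[ k < n ] χ (2 * k ≟ suc (2 * h)) ≡ 0
∑-χ-odd n h = ∑-χ-miss n (2 *_) λ k _ → even≢odd k h

∑-χ-twice-below : ∀ n i → i < n → ∑[ k < n ] (χ (k ≟ i) + χ (k ≟ i)) ≡ 2
∑-χ-twice-below n i i<n = trans (∑-+ n _ _) (cong₂ _+_ (∑-χ-below n i i<n) (∑-χ-below n i i<n))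

rowDegree-split : ∀ q i → rowDegree q i ≡ ∑[ k < 4 * q ] χ (k ≟ i) + ∑[ k < 4 * q ] χ (suc k ≟ i)
                                         + ∑[ k < suc (2 * q) ] χ (2 * k ≟ i)
rowDegree-split q i = cong (_+ ∑[ k < suc (2 * q) ] χ (2 * k ≟ i)) (∑-+ (4 * q) _ _)

4*q≡2*[2*q] : ∀ q → 4 * q ≡ 2 * (2 * q)
4*q≡2*[2*q] q = *-assoc 2 2 q

rowDegree-start : ∀ q' → rowDegree (suc q') 0 ≡ 2
rowDegree-start q' = trans (rowDegree-split (suc q') 0)
  (cong₂ _+_ (cong₂ _+_ (∑-χ-below (4 * suc q') 0 (s≤s z≤n)) (∑-χ-suc-0 (4 * suc q')))
             (∑-χ-even (suc (2 * suc q')) 0 (s≤s z≤n)))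

rowDegree-end : ∀ q' → rowDegree (suc q') (2 * (2 * suc q')) ≡ 2
rowDegree-end q' = trans (rowDegree-split q (2 * (2 * q)))
  (cong₂ _+_ (cong₂ _+_ (∑-χ-above (4 * q) _ (≤-reflexive (4*q≡2*[2*q] q))) right)
             (∑-χ-even (suc (2 * q)) (2 * q) ≤-refl))
  where
  q = suc q'
  -- 4 * q is syntactically a successor, so the last path edge reaches it.
  right : ∑[ k < 4 * q ] χ (suc k ≟ 2 * (2 * q)) ≡ 1
  right = trans (cong (λ n → ∑[ k < 4 * q ] χ (suc k ≟ n)) (sym (4*q≡2*[2*q] q)))
                (∑-χ-suc (4 * q) (q' + 3 * q) ≤-refl)

inner<4q : ∀ q h → suc h < 2 * q → suc (suc (2 * h)) < 4 * q
inner<4q q h sh<2q = subst₂ _<_ (*-suc 2 h) (sym (4*q≡2*[2*q] q)) (*-monoʳ-< 2 sh<2q)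

odd<4q : ∀ q h → h < 2 * q → suc (2 * h) < 4 * q
odd<4q q h h<2q = subst₂ _≤_ (*-suc 2 h) (sym (4*q≡2*[2*q] q)) (*-monoʳ-≤ 2 h<2q)

rowDegree-inner : ∀ q h → suc h < 2 * q → rowDegree q (2 * suc h) ≡ 3
rowDegree-inner q h sh<2q = trans (rowDegree-split q (2 * suc h)) (cong₂ _+_ (cong₂ _+_ left right) rung)
  where
  i<4q : suc (suc (2 * h)) < 4 * q
  i<4q = inner<4q q h sh<2q
  left : ∑[ k < 4 * q ] χ (k ≟ 2 * suc h) ≡ 1
  left = ∑-χ-below (4 * q) _ (subst (_< 4 * q) (sym (*-suc 2 h)) i<4q)
  right : ∑[ k < 4 * q ] χ (suc k ≟ 2 * suc h) ≡ 1
  right = trans (cong (λ i → ∑[ k < 4 * q ] χ (suc k ≟ i)) (*-suc 2 h))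
                (∑-χ-suc (4 * q) _ (<-trans (n<1+n _) i<4q))
  rung : ∑[ k < suc (2 * q) ] χ (2 * k ≟ 2 * suc h) ≡ 1
  rung = ∑-χ-even (suc (2 * q)) (suc h) (m<n⇒m<1+n sh<2q)

rowDegree-odd : ∀ q h → h < 2 * q → rowDegree q (suc (2 * h)) ≡ 2
rowDegree-odd q h h<2q = trans (rowDegree-split q (suc (2 * h)))
  (cong₂ _+_ (cong₂ _+_ (∑-χ-below (4 * q) _ (odd<4q q h h<2q))
                        (∑-χ-suc (4 * q) _ (<-trans (n<1+n _) (odd<4q q h h<2q))))
             (∑-χ-odd (suc (2 * q)) h))

odd-4k+1 : ∀ k → suc (2 * (2 * k)) ≡ 4 * k + 1
odd-4k+1 k = trans (cong suc (sym (*-assoc 2 2 k))) (+-comm 1 (4 * k))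

odd-4k+3 : ∀ k → suc (2 * suc (2 * k)) ≡ 4 * k + 3
odd-4k+3 k = trans (cong suc (*-suc 2 (2 * k))) (trans (cong (λ s → 3 + s) (sym (*-assoc 2 2 k))) (+-comm 3 (4 * k)))

bandDegree-odds : ∀ q i → bandDegree q i ≡ ∑[ h < 2 * q ] χ (suc (2 * h) ≟ i)
bandDegree-odds q i = sym (trans (∑-pairs q (λ h → χ (suc (2 * h) ≟ i))) (∑-cong q λ k _ →
  cong₂ _+_ (cong (λ j → χ (j ≟ i)) (odd-4k+1 k)) (cong (λ j → χ (j ≟ i)) (odd-4k+3 k))))

bandDegree-even : ∀ q h → bandDegree q (2 * h) ≡ 0
bandDegree-even q h = trans (bandDegree-odds q (2 * h)) (∑-χ-miss (2 * q) _ λ k _ → even≢odd h k ∘ sym)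

bandDegree-odd : ∀ q h → h < 2 * q → bandDegree q (suc (2 * h)) ≡ 1
bandDegree-odd q h h<2q = trans (bandDegree-odds q (suc (2 * h)))
  (∑-χ-hit (2 * q) (suc ∘ (2 *_)) (*-cancelˡ-≡ _ _ 2 ∘ suc-injective) h h<2q)

uDegree-first : ∀ q' → uDegree (suc q') 0 ≡ 2
uDegree-first q' = cong₂ _+_ (∑-χ-twice-below (suc q') 0 (s≤s z≤n)) (∑-χ-suc-0 q')

uDegree-rest : ∀ q' k → k < q' → uDegree (suc q') (suc k) ≡ 3
uDegree-rest q' k k<q' = cong₂ _+_ (∑-χ-twice-below (suc q') (suc k) (s≤s k<q')) (∑-χ-suc q' k k<q')

wDegree-rest : ∀ q' k → k < q' → wDegree (suc q') k ≡ 3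
wDegree-rest q' k k<q' = cong₂ _+_ (∑-χ-twice-below (suc q') k (m<n⇒m<1+n k<q')) (∑-χ-below q' k k<q')

wDegree-last : ∀ q' → wDegree (suc q') q' ≡ 2
wDegree-last q' = cong₂ _+_ (∑-χ-twice-below (suc q') q' ≤-refl) (∑-χ-above q' q' ≤-refl)

record PathShape (n β : ℕ) (d : ℕ → ℕ) : Set where
  field
    start : d 0 ≡ 2
    end   : d (2 * suc n) ≡ 2
    inner : ∀ h → h < n → d (2 * suc h) ≡ 3
    odd   : ∀ h → h < suc n → d (suc (2 * h)) ≡ β

record ChainShape (n : ℕ) (du dw : ℕ → ℕ) : Set where
  field
    first  : du 0 ≡ 2
    u-rest : ∀ k → k < n → du (suc k) ≡ 3
    w-rest : ∀ k → k < n → dw k ≡ 3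
    last   : dw n ≡ 2

module _ (T : ℕ → ℕ → ℕ) where

  pathValue : ℕ → ℕ → ℕ
  pathValue n β = (T 2 β + n * T 3 β) + (n * T β 3 + T β 2)

  path-sum : ∀ {n β d} → PathShape n β d → ∑[ k < 2 * suc n ] T (d k) (d (suc k)) ≡ pathValue n β
  path-sum {n} {β} {d} shape = begin
    ∑[ k < 2 * suc n ] T (d k) (d (suc k))
      ≡⟨ ∑-pairs (suc n) (λ k → T (d k) (d (suc k))) ⟩
    ∑[ h < suc n ] (left h + right h)
      ≡⟨ ∑-+ (suc n) left right ⟩
    ∑ (suc n) left + ∑ (suc n) right
      ≡⟨ cong₂ _+_ lefts rights ⟩
    pathValue n β ∎
    where
    open ≡-Reasoning
    open PathShape shape
    left right : ℕ → ℕ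
    left h = T (d (2 * h)) (d (suc (2 * h)))
    right h = T (d (suc (2 * h))) (d (suc (suc (2 * h))))
    right-even : ∀ h {x} → d (2 * suc h) ≡ x → d (suc (suc (2 * h))) ≡ x
    right-even h = trans (cong d (sym (*-suc 2 h)))
    lefts : ∑ (suc n) left ≡ T 2 β + n * T 3 β
    lefts = ∑-head n left (cong₂ T start (odd 0 (s≤s z≤n))) λ h h<n → cong₂ T (inner h h<n) (odd (suc h) (s≤s h<n))
    rights : ∑ (suc n) right ≡ n * T β 3 + T β 2
    rights = ∑-tail n right (λ h h<n → cong₂ T (odd h (m<n⇒m<1+n h<n)) (right-even h (inner h h<n)))
                            (cong₂ T (odd n ≤-refl) (right-even n end))

  rungValue : ℕ → ℕ
  rungValue n = (T 2 2 + n * T 3 3) + T 2 2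

  rung-sum : ∀ {n βb βt db dt} → PathShape n βb db → PathShape n βt dt →
             ∑[ k < suc (suc n) ] T (db (2 * k)) (dt (2 * k)) ≡ rungValue n
  rung-sum {n} {db = db} {dt = dt} bottom top = trans (∑-last (suc n) (λ k → T (db (2 * k)) (dt (2 * k)))) (cong₂ _+_
    (∑-head n (λ k → T (db (2 * k)) (dt (2 * k))) (cong₂ T (PathShape.start bottom) (PathShape.start top))
              λ h h<n → cong₂ T (PathShape.inner bottom h h<n) (PathShape.inner top h h<n))
    (cong₂ T (PathShape.end bottom) (PathShape.end top)))

  spokePair : ℕ → ℕ
  spokePair x = T x 3 + T x 3

  bandValue : ℕ → ℕ
  bandValue n = ((spokePair 2 + n * spokePair 3) + (n * spokePair 3 + spokePair 2)) + n * T 3 3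

  band-sum : ∀ {n du dw} (s₁ s₂ s₃ s₄ : ℕ → ℕ) → ChainShape n du dw →
             (∀ k → k < suc n → s₁ k ≡ 3 × s₂ k ≡ 3 × s₃ k ≡ 3 × s₄ k ≡ 3) →
             ∑[ k < suc n ] ((T (du k) (s₁ k) + T (du k) (s₂ k)) + (T (dw k) (s₃ k) + T (dw k) (s₄ k)))
             + ∑[ k < n ] T (dw k) (du (suc k))
             ≡ bandValue n
  band-sum {n} {du} {dw} s₁ s₂ s₃ s₄ shape spoke-ends = cong₂ _+_
    (trans (∑-cong (suc n) spokes-at) (trans (∑-+ (suc n) (spokePair ∘ du) (spokePair ∘ dw))
      (cong₂ _+_ (∑-head n (spokePair ∘ du) (cong spokePair first) λ k k<n → cong spokePair (u-rest k k<n))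
                 (∑-tail n (spokePair ∘ dw) (λ k k<n → cong spokePair (w-rest k k<n)) (cong spokePair last)))))
    (∑-const n (T 3 3) λ k k<n → cong₂ T (w-rest k k<n) (u-rest k k<n))
    where
    open ChainShape shape
    spokes-at : ∀ k → k < suc n →
                (T (du k) (s₁ k) + T (du k) (s₂ k)) + (T (dw k) (s₃ k) + T (dw k) (s₄ k))
                ≡ spokePair (du k) + spokePair (dw k)
    spokes-at k k<n with spoke-ends k k<n
    ... | e₁ , e₂ , e₃ , e₄ = cong₂ _+_ (cong₂ _+_ (cong (T (du k)) e₁) (cong (T (du k)) e₂))
                                        (cong₂ _+_ (cong (T (dw k)) e₃) (cong (T (dw k)) e₄))

τ : ℕ → ℕ → ℕ → ℕ → ℕ
τ i j x y = χ (((x ≟ i) ×-dec (y ≟ j)) ⊎-dec ((x ≟ j) ×-dec (y ≟ i)))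

τ-miss-left : ∀ i j x y → x ≢ i → y ≢ i → τ i j x y ≡ 0
τ-miss-left i j x y x≢i y≢i = χ-no (((x ≟ i) ×-dec (y ≟ j)) ⊎-dec ((x ≟ j) ×-dec (y ≟ i)))
  λ { (inj₁ (x≡i , _)) → x≢i x≡i ; (inj₂ (_ , y≡i)) → y≢i y≡i }

τ-miss-right : ∀ i j x y → x ≢ j → y ≢ j → τ i j x y ≡ 0
τ-miss-right i j x y x≢j y≢j = χ-no (((x ≟ i) ×-dec (y ≟ j)) ⊎-dec ((x ≟ j) ×-dec (y ≟ i)))
  λ { (inj₁ (_ , y≡j)) → y≢j y≡j ; (inj₂ (x≡j , _)) → x≢j x≡j }

-- G(p, q'+1): each row is a chain of 2q' + 2 hexagons, each band a chain of q' + 1 octagons.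
module Shapes (p q' : ℕ) where

  q n : ℕ
  q = suc q'
  n = suc (2 * q')

  D : V → ℕ
  D = degree (G p q)

  2q≡1+n : 2 * q ≡ suc n
  2q≡1+n = *-suc 2 q'

  path-shape : ∀ a (d extra : ℕ → ℕ) → (∀ i → d i ≡ rowDegree q i + extra i) →
               (∀ h → extra (2 * h) ≡ 0) → (∀ h → h < 2 * q → extra (suc (2 * h)) ≡ a) →
               PathShape n (2 + a) d
  path-shape a d extra d≡ even odd = record
    { start = trans (d≡ 0) (cong₂ _+_ (rowDegree-start q') (even 0))
    ; end   = trans (cong d (cong (2 *_) (sym 2q≡1+n)))
                    (trans (d≡ _) (cong₂ _+_ (rowDegree-end q') (even (2 * q))))
    ; inner = λ h h<n → trans (d≡ _) (cong₂ _+_ (rowDegree-inner q h (subst (suc h <_) (sym 2q≡1+n) (s≤s h<n)))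
                                                 (even (suc h)))
    ; odd   = λ h h<1+n → let h<2q = subst (h <_) (sym 2q≡1+n) h<1+n in
                trans (d≡ _) (cong₂ _+_ (rowDegree-odd q h h<2q) (odd h h<2q))
    }

  boundary-path : ∀ (d : ℕ → ℕ) → (∀ i → d i ≡ rowDegree q i) → PathShape n 2 d
  boundary-path d d≡ =
    path-shape 0 d (λ _ → 0) (λ i → trans (d≡ i) (sym (+-identityʳ _))) (λ _ → refl) (λ _ _ → refl)

  banded-path : ∀ (d : ℕ → ℕ) → (∀ i → d i ≡ rowDegree q i + bandDegree q i) → PathShape n 3 d
  banded-path d d≡ = path-shape 1 d (bandDegree q) d≡ (bandDegree-even q) (bandDegree-odd q)

  shape-b₀ : PathShape n 2 (D ∘ b 0)
  shape-b₀ = boundary-path (D ∘ b 0) (degree-b₀ p q)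

  shape-b : ∀ r → r < p → PathShape n 3 (D ∘ b (suc r))
  shape-b r r<p = banded-path (D ∘ b (suc r)) λ i → degree-b p q r i r<p

  shape-tₚ : PathShape n 2 (D ∘ t p)
  shape-tₚ = boundary-path (D ∘ t p) (degree-tₚ p q)

  shape-t : ∀ s → s < p → PathShape n 3 (D ∘ t s)
  shape-t s s<p = banded-path (D ∘ t s) λ i → degree-t p q s i s<p

  shape-chain : ∀ r → r < p → ChainShape q' (D ∘ u r) (D ∘ w r)
  shape-chain r r<p = record
    { first  = trans (degree-u p q r 0 r<p) (uDegree-first q')
    ; u-rest = λ k k<q' → trans (degree-u p q r (suc k) r<p) (uDegree-rest q' k k<q')
    ; w-rest = λ k k<q' → trans (degree-w p q r k r<p) (wDegree-rest q' k k<q')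
    ; last   = trans (degree-w p q r q' r<p) (wDegree-last q')
    }

  spoke-end-1 : ∀ {β d} → PathShape n β d → ∀ k → k < q → d (4 * k + 1) ≡ β
  spoke-end-1 {d = d} shape k k<q = trans (cong d (sym (odd-4k+1 k)))
    (PathShape.odd shape (2 * k) (subst (2 * k <_) 2q≡1+n (*-monoʳ-< 2 k<q)))

  spoke-end-3 : ∀ {β d} → PathShape n β d → ∀ k → k < q → d (4 * k + 3) ≡ β
  spoke-end-3 {d = d} shape k k<q = trans (cong d (sym (odd-4k+3 k)))
    (PathShape.odd shape (suc (2 * k)) (subst₂ _≤_ (*-suc 2 k) 2q≡1+n (*-monoʳ-≤ 2 k<q)))

  module TypeCount (i j : ℕ) where

    open EdgeCount (hasDegreeType? (G p q) i j) q

    row-value : ∀ r {βb βt} → PathShape n βb (D ∘ b r) → PathShape n βt (D ∘ t r) →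
                rowCount r ≡ pathValue (τ i j) n βb + (pathValue (τ i j) n βt + rungValue (τ i j) n)
    row-value r bottom top = cong₂ _+_
      (trans (cong (λ N → ∑[ k < N ] τ i j (D (b r k)) (D (b r (suc k)))) path-length) (path-sum (τ i j) bottom))
      (cong₂ _+_
        (trans (cong (λ N → ∑[ k < N ] τ i j (D (t r k)) (D (t r (suc k)))) path-length) (path-sum (τ i j) top))
        (trans (cong (λ N → ∑[ k < suc N ] τ i j (D (b r (2 * k))) (D (t r (2 * k)))) 2q≡1+n)
               (rung-sum (τ i j) bottom top)))
      where
      path-length : 4 * q ≡ 2 * suc n
      path-length = trans (4*q≡2*[2*q] q) (cong (2 *_) 2q≡1+n)

    band-value : ∀ r → r < p → bandCount r ≡ bandValue (τ i j) q'
    band-value r r<p = trans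
      (cong (_+ ∑[ k < q' ] τ i j (D (w r k)) (D (u r (suc k))))
            (∑-cong q λ k _ → count-spokes (hasDegreeType? (G p q) i j) r k))
      (band-sum (τ i j) (D ∘ t r ∘ 4k+1) (D ∘ b (suc r) ∘ 4k+1) (D ∘ t r ∘ 4k+3) (D ∘ b (suc r) ∘ 4k+3)
                (shape-chain r r<p) spoke-ends)
      where
      4k+1 4k+3 : ℕ → ℕ
      4k+1 k = 4 * k + 1
      4k+3 k = 4 * k + 3
      spoke-ends : ∀ k → k < q → D (t r (4k+1 k)) ≡ 3 × D (b (suc r) (4k+1 k)) ≡ 3
                                × D (t r (4k+3 k)) ≡ 3 × D (b (suc r) (4k+3 k)) ≡ 3
      spoke-ends k k<q = spoke-end-1 (shape-t r r<p) k k<q , spoke-end-1 (shape-b r r<p) k k<q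
                       , spoke-end-3 (shape-t r r<p) k k<q , spoke-end-3 (shape-b r r<p) k k<q

-- The total weight of the edges of G(p' + 1, q' + 1) for an edge weight T depending
-- on the end-degrees: bottom row, p' middle rows, top row, and p' + 1 bands.
edgeTally : (ℕ → ℕ → ℕ) → ℕ → ℕ → ℕ
edgeTally T p' q' = (P 2 + (P 3 + Z)) + (p' * (P 3 + (P 3 + Z)) + (P 3 + (P 2 + Z))) + suc p' * bandValue T q'
  where
  P : ℕ → ℕ
  P = pathValue T (suc (2 * q'))
  Z : ℕ
  Z = rungValue T (suc (2 * q'))

m-tally : ∀ p' q' i j → m (G (suc p') (suc q')) i j ≡ edgeTally (τ i j) p' q'
m-tally p' q' i j = trans (EdgeCount.count-G (hasDegreeType? (G p q) i j) q p) (cong₂ _+_ rows bands)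
  where
  p = suc p'
  open Shapes p q'
  open TypeCount i j
  open EdgeCount (hasDegreeType? (G p q) i j) q
  P : ℕ → ℕ
  P = pathValue (τ i j) n
  Z : ℕ
  Z = rungValue (τ i j) n
  rows : ∑[ r < suc p ] rowCount r ≡ (P 2 + (P 3 + Z)) + (p' * (P 3 + (P 3 + Z)) + (P 3 + (P 2 + Z)))
  rows = cong₂ _+_ (row-value 0 shape-b₀ (shape-t 0 (s≤s z≤n)))
    (∑-tail p' (rowCount ∘ suc)
      (λ r r<p' → row-value (suc r) (shape-b r (m<n⇒m<1+n r<p')) (shape-t (suc r) (s≤s r<p')))
      (row-value p (shape-b p' ≤-refl) shape-tₚ))
  bands : ∑[ r < p ] bandCount r ≡ p * bandValue (τ i j) q'
  bands = ∑-const p _ band-value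

-- The edge tally of G(p' + 1, q' + 1) as a linear form in the weights a = T 2 2,
-- c = T 2 3, c' = T 3 2, e = T 3 3 (an edge of type {2, 3} is weighted by c or c'
-- according to the order of its ends in the edge list).
tallyForm : ℕ → ℕ → ℕ → ℕ → ℕ → ℕ → ℕ
tallyForm p' q' a c c' e = (2 * p' + 8) * a + (6 * p' + 4 * q' + 8) * c
                         + (2 * p' + 4 * q' + 4) * c' + (15 * p' * q' + 5 * p' + 17 * q' + 6) * e

edgeTally-form : ∀ T p' q' → edgeTally T p' q' ≡ tallyForm p' q' (T 2 2) (T 2 3) (T 3 2) (T 3 3)
edgeTally-form T p' q' = expand p' q' (T 2 2) (T 2 3) (T 3 2) (T 3 3)
  where
  expand : ∀ p' q' a c c' e →
    let n = suc (2 * q')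
        P₂ = (a + n * c') + (n * c + a)
        P₃ = (c + n * e) + (n * e + c')
        Z = (a + n * e) + a
        B = (((c + c) + q' * (e + e)) + (q' * (e + e) + (c + c))) + q' * e
    in (P₂ + (P₃ + Z)) + (p' * (P₃ + (P₃ + Z)) + (P₃ + (P₂ + Z))) + suc p' * B
       ≡ (2 * p' + 8) * a + (6 * p' + 4 * q' + 8) * c
       + (2 * p' + 4 * q' + 4) * c' + (15 * p' * q' + 5 * p' + 17 * q' + 6) * e
  expand = ℕ-Solver.solve-∀

typeForm : ℕ → ℕ → ℕ → ℕ → ℕ
typeForm p' q' i j = tallyForm p' q' (τ i j 2 2) (τ i j 2 3) (τ i j 3 2) (τ i j 3 3)

m-form : ∀ p' q' i j → m (G (suc p') (suc q')) i j ≡ typeForm p' q' i j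
m-form p' q' i j = trans (m-tally p' q' i j) (edgeTally-form (τ i j) p' q')

-- Passing to ℤ: subtracting the summands that were moved across.
cast-minus : ∀ n x k → n + k ≡ x → + n ≡ + x ℤ.- + k
cast-minus n x k n+k≡x = trans (cancel (+ n) (+ k)) (cong (λ s → + s ℤ.- + k) n+k≡x)
  where
  cancel : ∀ a₁ a₂ → a₁ ≡ a₁ ℤ.+ a₂ ℤ.- a₂
  cancel = ℤ-Solver.solve-∀

cast-minus-plus-minus : ∀ n x y z k → n + y + k ≡ x + z → + n ≡ + x ℤ.- + y ℤ.+ + z ℤ.- + k
cast-minus-plus-minus n x y z k n+y+k≡x+z =
  trans (cancel (+ n) (+ y) (+ k)) (trans (cong (λ s → + s ℤ.- + y ℤ.- + k) n+y+k≡x+z) (reorder (+ x) (+ y) (+ z) (+ k)))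
  where
  cancel : ∀ a₁ a₂ a₃ → a₁ ≡ a₁ ℤ.+ a₂ ℤ.+ a₃ ℤ.- a₂ ℤ.- a₃
  cancel = ℤ-Solver.solve-∀
  reorder : ∀ a₁ a₂ a₃ a₄ → a₁ ℤ.+ a₃ ℤ.- a₂ ℤ.- a₄ ≡ a₁ ℤ.- a₂ ℤ.+ a₃ ℤ.- a₄
  reorder = ℤ-Solver.solve-∀

tallyForm-zero : ∀ p' q' → tallyForm p' q' 0 0 0 0 ≡ 0
tallyForm-zero p' q' = zero-form (2 * p' + 8) (6 * p' + 4 * q' + 8) (2 * p' + 4 * q' + 4) (15 * p' * q' + 5 * p' + 17 * q' + 6)
  where
  zero-form : ∀ x y z w → x * 0 + y * 0 + z * 0 + w * 0 ≡ 0
  zero-form = ℕ-Solver.solve-∀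

no-edges-left : ∀ p' q' i j → 2 ≢ i → 3 ≢ i → typeForm p' q' i j ≡ 0
no-edges-left p' q' i j 2≢i 3≢i
  rewrite τ-miss-left i j 2 2 2≢i 2≢i | τ-miss-left i j 2 3 2≢i 3≢i
        | τ-miss-left i j 3 2 3≢i 2≢i | τ-miss-left i j 3 3 3≢i 3≢i = tallyForm-zero p' q'

no-edges-right : ∀ p' q' i j → 2 ≢ j → 3 ≢ j → typeForm p' q' i j ≡ 0
no-edges-right p' q' i j 2≢j 3≢j
  rewrite τ-miss-right i j 2 2 2≢j 2≢j | τ-miss-right i j 2 3 2≢j 3≢j
        | τ-miss-right i j 3 2 3≢j 2≢j | τ-miss-right i j 3 3 3≢j 3≢j = tallyForm-zero p' q'

coefficient : ∀ p' q' i j → i ≤ j → + typeForm p' q' i j ≡ targetCoeff (suc p') (suc q') i j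
coefficient p' q' 2 2 _ = cong +_ (x22 p' q')
  where
  x22 : ∀ p' q' → (2 * p' + 8) * 1 + (6 * p' + 4 * q' + 8) * 0
                  + (2 * p' + 4 * q' + 4) * 0 + (15 * p' * q' + 5 * p' + 17 * q' + 6) * 0
                  ≡ 2 * suc p' + 6
  x22 = ℕ-Solver.solve-∀
coefficient p' q' 2 3 _ = cast-minus _ (8 * suc p' + 8 * suc q') 4 (x23 p' q')
  where
  x23 : ∀ p' q' → (2 * p' + 8) * 0 + (6 * p' + 4 * q' + 8) * 1
                  + (2 * p' + 4 * q' + 4) * 1 + (15 * p' * q' + 5 * p' + 17 * q' + 6) * 0 + 4
                  ≡ 8 * suc p' + 8 * suc q'
  x23 = ℕ-Solver.solve-∀
coefficient p' q' 3 3 _ = cast-minus-plus-minus _ (15 * suc p' * suc q') (10 * suc p') (2 * suc q') 1 (x33 p' q')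
  where
  x33 : ∀ p' q' → (2 * p' + 8) * 0 + (6 * p' + 4 * q' + 8) * 0
                  + (2 * p' + 4 * q' + 4) * 0 + (15 * p' * q' + 5 * p' + 17 * q' + 6) * 1 + 10 * suc p' + 1
                  ≡ 15 * suc p' * suc q' + 2 * suc q'
  x33 = ℕ-Solver.solve-∀
coefficient p' q' 0 j _ = cong +_ (no-edges-left p' q' 0 j (λ ()) (λ ()))
coefficient p' q' 1 j _ = cong +_ (no-edges-left p' q' 1 j (λ ()) (λ ()))
coefficient p' q' (suc (suc (suc (suc i)))) j _ = cong +_ (no-edges-left p' q' (4 + i) j (λ ()) (λ ()))
coefficient p' q' 2 (suc (suc (suc (suc j)))) _ = cong +_ (no-edges-right p' q' 2 (4 + j) (λ ()) (λ ()))
coefficient p' q' 3 (suc (suc (suc (suc j)))) _ = cong +_ (no-edges-right p' q' 3 (4 + j) (λ ()) (λ ()))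
coefficient p' q' 2 0 ()
coefficient p' q' 2 1 (s≤s ())
coefficient p' q' 3 0 ()
coefficient p' q' 3 1 (s≤s ())
coefficient p' q' 3 2 (s≤s (s≤s ()))

mainTheorem4 : (p q : ℕ) → 1 ≤ p → 1 ≤ q →
    (i j : ℕ) → i ≤ j → + (m (G p q) i j) ≡ targetCoeff p q i j
mainTheorem4 (suc p') (suc q') _ _ i j i≤j = trans (cong +_ (m-form p' q' i j)) (coefficient p' q' i j i≤j)
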